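{- Let $m\ge2$ be an integer. Define $sf(n,m)$ for integers $n$ by $sf(n,m)=0$ for $n<0$, $sf(0,m)=1$, and for $n>0$: $sf(n,m)=sf(n/m,m)$ if $n\equiv0\pmod m$, and $sf(n,m)=sf(n-r,m)+sf(n-m,m)$ if $n\equiv r\pmod m$ with $0<r<m$. Then: (i) $sf(m^i,m)=1$ for all $i\ge0$; (ii) $sf(m^ih,m)=1$ for all $i\ge0$ and $1\le h\le m-1$; (iii) for each $n\in\{0,1,\dots,m\}$, $$sf(nm+1,m)=sf(nm+2,m)=\cdots=sf((n+1)m-1,m)=n+1.$$
   Context: $sf(n,m)$ is the number of semi-$m$-Fibonacci partitions of $n$, characterized by the stated recurrence. -}

module Defs where

open import Data.Nat using (ℕ; zero; suc; _+_; _*_; _∸_; _<ᵇ_; NonZero)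
open import Data.Nat.DivMod using (_/_; _%_)
open import Data.Bool using (if_then_else_)

-- sf(n,m) for n : ℕ (values at negative arguments are 0, handled by the
-- "n < m" test in the term sf(n-m,m)).  Defined with a fuel parameter
-- (fuel k suffices whenever n < k, since every recursive call is on a
-- strictly smaller natural number).
--   sf(0,m) = 1
--   n > 0, n ≡ 0 (mod m):      sf(n,m) = sf(n/m,m)
--   n > 0, n ≡ r (mod m), 0<r: sf(n,m) = sf(n-r,m) + sf(n-m,m)
sf-fuel : ℕ → (n m : ℕ) → .{{NonZero m}} → ℕ
sf-fuel zero    n       m = 0
sf-fuel (suc k) zero    m = 1
sf-fuel (suc k) (suc n) m with suc n % m
... | zero   = sf-fuel k (suc n / m) m
... | suc r' = sf-fuel k (suc n ∸ suc r') m
             + (if suc n <ᵇ m then 0 else sf-fuel k (suc n ∸ m) m)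

sf : (n m : ℕ) → .{{NonZero m}} → ℕ
sf n m = sf-fuel (suc n) n m

-- Multiplying by m is invisible to sf, since the recursion divides the factor
-- back out; hence sf(m^i h) = sf(h), and sf(h) = 1 for 0 < h < m because the
-- second summand sf(h - m) vanishes there.  For 0 < j < m the recurrence reads
-- sf((n+1)m + j) = sf(n+1) + sf(nm + j), and sf(n+1) = 1 as long as n+1 ≤ m,
-- so sf(nm + j) = n + 1 by induction on n.
module Submission where

open import Defs
open import Data.Nat using (ℕ; zero; suc; _+_; _*_; _^_; _≤_; _<_; _∸_; NonZero; z≤n; s≤s; z<s; _<ᵇ_)
open import Data.Nat.Properties
open import Data.Nat.DivMod using (_%_; _/_; m/n<m; 0/n≡0; m<n⇒m%n≡m; [m+kn]%n≡m%n; m*n%n≡0; m*n/n≡m)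
open import Data.Bool using (true; false; if_then_else_)
open import Data.Unit using (tt)
open import Data.Empty using (⊥-elim)
open import Data.Product using (_×_; _,_)
open import Data.Sum using (inj₁; inj₂)
open import Relation.Binary.PropositionalEquality

<⇒<ᵇ≡true : ∀ {a b} → a < b → (a <ᵇ b) ≡ true
<⇒<ᵇ≡true {a} {b} a<b with a <ᵇ b | <⇒<ᵇ a<b
... | true | _ = refl

≥⇒<ᵇ≡false : ∀ {a b} → b ≤ a → (a <ᵇ b) ≡ false
≥⇒<ᵇ≡false {a} {b} b≤a with a <ᵇ b | <ᵇ⇒< a b
... | false | _   = refl
... | true  | a<b = ⊥-elim (<⇒≱ (a<b tt) b≤a)

module _ (m : ℕ) .{{_ : NonZero m}} (1<m : 1 < m) where

  sf-fuel-stable : ∀ a b n → n < a → n < b → sf-fuel a n m ≡ sf-fuel b n m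
  sf-fuel-stable (suc a) (suc b) zero    _         _         = refl
  sf-fuel-stable (suc a) (suc b) (suc n) (s≤s n<a) (s≤s n<b) with suc n % m
  ... | zero   = sf-fuel-stable a b (suc n / m) (≤-trans quotient< n<a) (≤-trans quotient< n<b)
    where
    quotient< : suc n / m < suc n
    quotient< = m/n<m (suc n) m 1<m
  ... | suc r = cong₂ _+_
      (sf-fuel-stable a b (n ∸ r) (≤-<-trans (m∸n≤m n r) n<a) (≤-<-trans (m∸n≤m n r) n<b))
      (previous-block (suc n <ᵇ m))
    where
    suc-n∸m≤n : suc n ∸ m ≤ n
    suc-n∸m≤n = ∸-monoʳ-≤ (suc n) (<⇒≤ 1<m)
    previous-block : ∀ t → (if t then 0 else sf-fuel a (suc n ∸ m) m)
                         ≡ (if t then 0 else sf-fuel b (suc n ∸ m) m)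
    previous-block true  = refl
    previous-block false =
      sf-fuel-stable a b (suc n ∸ m) (≤-<-trans suc-n∸m≤n n<a) (≤-<-trans suc-n∸m≤n n<b)

  sf-fuel-adequate : ∀ a n → n < a → sf-fuel a n m ≡ sf n m
  sf-fuel-adequate a n n<a = sf-fuel-stable a (suc n) n n<a ≤-refl

  sf-unfold-divisible : ∀ x → x % m ≡ 0 → sf x m ≡ sf (x / m) m
  sf-unfold-divisible zero    _ = cong (λ y → sf y m) (sym (0/n≡0 m))
  sf-unfold-divisible (suc n) _ with suc n % m
  ... | zero = sf-fuel-adequate (suc n) (suc n / m) (m/n<m (suc n) m 1<m)

  sf-unfold-residue : ∀ x r → x % m ≡ suc r →
    sf x m ≡ sf (x ∸ suc r) m + (if x <ᵇ m then 0 else sf (x ∸ m) m)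
  sf-unfold-residue zero    r 0%m≡1+r =
    ⊥-elim (0≢1+n (trans (sym (m<n⇒m%n≡m (<-trans z<s 1<m))) 0%m≡1+r))
  sf-unfold-residue (suc n) r x%m≡1+r with suc n % m | x%m≡1+r
  ... | .(suc r) | refl = cong₂ _+_
      (sf-fuel-adequate (suc n) (n ∸ r) (s≤s (m∸n≤m n r)))
      (previous-block (suc n <ᵇ m))
    where
    previous-block : ∀ t → (if t then 0 else sf-fuel (suc n) (suc n ∸ m) m)
                         ≡ (if t then 0 else sf (suc n ∸ m) m)
    previous-block true  = refl
    previous-block false =
      sf-fuel-adequate (suc n) (suc n ∸ m) (s≤s (∸-monoʳ-≤ (suc n) (<⇒≤ 1<m)))

  sf-unfold-residue-< : ∀ x r → x % m ≡ suc r → x < m → sf x m ≡ sf (x ∸ suc r) m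
  sf-unfold-residue-< x r x%m≡1+r x<m
    rewrite sf-unfold-residue x r x%m≡1+r | <⇒<ᵇ≡true x<m = +-identityʳ _

  sf-unfold-residue-≥ : ∀ x r → x % m ≡ suc r → m ≤ x →
    sf x m ≡ sf (x ∸ suc r) m + sf (x ∸ m) m
  sf-unfold-residue-≥ x r x%m≡1+r m≤x
    rewrite sf-unfold-residue x r x%m≡1+r | ≥⇒<ᵇ≡false m≤x = refl

  sf-*m : ∀ x → sf (x * m) m ≡ sf x m
  sf-*m x = trans (sf-unfold-divisible (x * m) (m*n%n≡0 x m)) (cong (λ y → sf y m) (m*n/n≡m x m))

  sf-m^i* : ∀ i x → sf (m ^ i * x) m ≡ sf x m
  sf-m^i* zero    x = cong (λ y → sf y m) (*-identityˡ x)
  sf-m^i* (suc i) x = begin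
    sf (m * m ^ i * x) m   ≡⟨ cong (λ y → sf y m) (trans (*-assoc m (m ^ i) x) (*-comm m (m ^ i * x))) ⟩
    sf (m ^ i * x * m) m   ≡⟨ sf-*m (m ^ i * x) ⟩
    sf (m ^ i * x) m       ≡⟨ sf-m^i* i x ⟩
    sf x m                 ∎
    where open ≡-Reasoning

  sf-<m : ∀ h → 0 < h → h < m → sf h m ≡ 1
  sf-<m (suc r) _ h<m = trans (sf-unfold-residue-< (suc r) r (m<n⇒m%n≡m h<m) h<m)
                              (cong (λ y → sf y m) (n∸n≡0 r))

  sf-≤m : ∀ h → 0 < h → h ≤ m → sf h m ≡ 1
  sf-≤m h 0<h h≤m with m≤n⇒m<n∨m≡n h≤m
  ... | inj₁ h<m  = sf-<m h 0<h h<m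
  ... | inj₂ refl = begin
    sf m m       ≡⟨ cong (λ y → sf y m) (sym (*-identityˡ m)) ⟩
    sf (1 * m) m ≡⟨ sf-*m 1 ⟩
    sf 1 m       ≡⟨ sf-<m 1 (s≤s z≤n) 1<m ⟩
    1            ∎
    where open ≡-Reasoning

  sf-step : ∀ n j → 0 < j → j < m → sf (suc n * m + j) m ≡ sf (suc n) m + sf (n * m + j) m
  sf-step n (suc r) _ j<m = begin
    sf x m                                     ≡⟨ sf-unfold-residue-≥ x r x%m≡j m≤x ⟩
    sf (x ∸ suc r) m + sf (x ∸ m) m            ≡⟨ cong₂ (λ y z → sf y m + sf z m) x∸j≡ x∸m≡ ⟩
    sf (suc n * m) m + sf (n * m + suc r) m    ≡⟨ cong (_+ sf (n * m + suc r) m) (sf-*m (suc n)) ⟩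
    sf (suc n) m + sf (n * m + suc r) m        ∎
    where
    open ≡-Reasoning
    x : ℕ
    x = suc n * m + suc r
    x%m≡j : x % m ≡ suc r
    x%m≡j = begin
      (suc n * m + suc r) % m   ≡⟨ cong (_% m) (+-comm (suc n * m) (suc r)) ⟩
      (suc r + suc n * m) % m   ≡⟨ [m+kn]%n≡m%n (suc r) (suc n) m ⟩
      suc r % m                 ≡⟨ m<n⇒m%n≡m j<m ⟩
      suc r                     ∎
    m≤x : m ≤ x
    m≤x = ≤-trans (m≤m+n m (n * m)) (m≤m+n (suc n * m) (suc r))
    x∸j≡ : x ∸ suc r ≡ suc n * m
    x∸j≡ = m+n∸n≡m (suc n * m) (suc r)
    x∸m≡ : x ∸ m ≡ n * m + suc r
    x∸m≡ = trans (cong (_∸ m) (+-assoc m (n * m) (suc r))) (m+n∸m≡n m (n * m + suc r))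

  sf-*m+ : ∀ n j → 0 < j → j < m → n ≤ m → sf (n * m + j) m ≡ n + 1
  sf-*m+ zero    j 0<j j<m _   = sf-<m j 0<j j<m
  sf-*m+ (suc n) j 0<j j<m n<m = begin
    sf (suc n * m + j) m           ≡⟨ sf-step n j 0<j j<m ⟩
    sf (suc n) m + sf (n * m + j) m ≡⟨ cong₂ _+_ (sf-≤m (suc n) (s≤s z≤n) n<m) (sf-*m+ n j 0<j j<m (<⇒≤ n<m)) ⟩
    suc n + 1                      ∎
    where open ≡-Reasoning

corollary3 : (m : ℕ) → .{{_ : NonZero m}} → 2 ≤ m →
    ((i : ℕ) → sf (m ^ i) m ≡ 1)
    × ((i h : ℕ) → 1 ≤ h → h ≤ m ∸ 1 → sf (m ^ i * h) m ≡ 1)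
    × ((n : ℕ) → n ≤ m → (j : ℕ) → 1 ≤ j → j ≤ m ∸ 1 → sf (n * m + j) m ≡ n + 1)
corollary3 m 1<m = powers , scaled-digits , blocks
  where
  scaled-digits : (i h : ℕ) → 1 ≤ h → h ≤ m ∸ 1 → sf (m ^ i * h) m ≡ 1
  scaled-digits i h 0<h h≤m-1 =
    trans (sf-m^i* m 1<m i h) (sf-<m m 1<m h 0<h (m≤pred[n]⇒suc[m]≤n h≤m-1))

  powers : (i : ℕ) → sf (m ^ i) m ≡ 1
  powers i = trans (cong (λ y → sf y m) (sym (*-identityʳ (m ^ i)))) (scaled-digits i 1 ≤-refl (suc[m]≤n⇒m≤pred[n] 1<m))

  blocks : (n : ℕ) → n ≤ m → (j : ℕ) → 1 ≤ j → j ≤ m ∸ 1 → sf (n * m + j) m ≡ n + 1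
  blocks n n≤m j 0<j j≤m-1 = sf-*m+ m 1<m n j 0<j (m≤pred[n]⇒suc[m]≤n j≤m-1) n≤m
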